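{- Let $r\ge2$ and let $G$ be the closure in $\Omega$ of the subgroup generated by $a_1,\dots,a_r$. Then the standard odometer $\gamma=(\gamma,\mathrm{id})\sigma$ is an element of $G$.
   Context: $T$ is the rooted binary tree of finite words over $X=\{0,1\}$, $\Omega=\mathrm{Aut}(T)$ with its profinite topology, acting on the right ($(v)(\alpha\beta)=((v)\alpha)\beta$). Each $\alpha\in\Omega$ is uniquely $(\alpha_0,\alpha_1)\tau$ with $\tau\in\{\mathrm{id},\sigma\}$ ($\sigma$ swaps $0,1$), meaning $(xv)\alpha=(x)\tau\,(v)\alpha_x$. The elements $a_1,\dots,a_r\in\Omega$ are defined recursively by $a_1=(a_r,\mathrm{id})\sigma$ and $a_i=(a_{i-1},\mathrm{id})$ for $2\le i\le r$; $\gamma$ is defined recursively by $\gamma=(\gamma,\mathrm{id})\sigma$. -}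

module Defs where

open import Data.Bool using (Bool; true; false; not; if_then_else_; _≟_)
open import Data.List using (List; []; _∷_; length)
open import Data.Nat using (ℕ; suc)
open import Data.Fin using (Fin; zero; suc; fromℕ; inject₁)
open import Data.Product using (_×_; _,_)
open import Relation.Nullary using (yes; no)

-- Vertices of the binary tree T: finite words over X = {0,1}, with 0 = false, 1 = true.
Word : Set
Word = List Bool

-- An element of Ω = Aut(T) is represented by its (right) action on words.
Act : Set
Act = Word → Word

-- Section / portrait reading: (x ∷ v)α = (x)τ ∷ (v)α_x.
-- Inverse of a tree automorphism given by its action:
-- (y w)α⁻¹ = x ((w)α_x⁻¹), where x is the letter with (x)τ = y,
-- τ read off from the first letter of (0)α and α_x(v) = tail((x v)α).
tail : Word → Word
tail []       = []
tail (_ ∷ v)  = v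

head0 : Act → Bool
head0 f with f (false ∷ [])
... | []    = false
... | b ∷ _ = b

inv : Act → Act
inv f []      = []
inv f (y ∷ w) with head0 f ≟ y
... | yes _ = false ∷ inv (λ v → tail (f (false ∷ v))) w
... | no  _ = true  ∷ inv (λ v → tail (f (true  ∷ v))) w

γ : Act
γ []           = []
γ (false ∷ v)  = true  ∷ γ v
γ (true  ∷ v)  = false ∷ v

-- The generators a₁,…,a_r for r = suc k; index zero ↦ a₁, index i ↦ a_{i+1}.
-- a₁ = (a_r, id)σ,  a_i = (a_{i-1}, id) for 2 ≤ i ≤ r.
a : (k : ℕ) → Fin (suc k) → Act
a k i       []           = []
a k zero    (false ∷ v)  = true  ∷ a k (fromℕ k) v
a k zero    (true  ∷ v)  = false ∷ v
a k (suc i) (false ∷ v)  = false ∷ a k (inject₁ i) v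
a k (suc i) (true  ∷ v)  = true  ∷ v

GroupWord : ℕ → Set
GroupWord k = List (Fin (suc k) × Bool)

gen : (k : ℕ) → Fin (suc k) × Bool → Act
gen k (i , false) = a k i
gen k (i , true)  = inv (a k i)

-- Right action: (v)(αβ) = ((v)α)β, so a word g₁ g₂ … acts by g₁ first.
eval : (k : ℕ) → GroupWord k → Act
eval k []       v = v
eval k (g ∷ gs) v = eval k gs (gen k g v)

-- Elements of the subgroup ⟨a₁,…,a_r⟩ are exactly the evaluations of group words.
-- β lies in the closure G of ⟨a₁,…,a_r⟩ in the profinite topology iff every basic
-- neighbourhood of β (elements agreeing with β on all vertices of length ≤ n)
-- meets the subgroup.
open import Data.Product using (Σ)
open import Data.Nat using (_≤_)
open import Relation.Binary.PropositionalEquality using (_≡_)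

InClosure : (k : ℕ) → Act → Set
InClosure k β = (n : ℕ) → Σ (GroupWord k) λ w →
  (v : Word) → length v ≤ n → eval k w v ≡ β v

-- With u = a_r a_{r-1} ⋯ a₁ one computes u = (a_r⁻¹ u a_r, id)σ. Since the diagonal
-- (g, g) lies in ⟨a₁,…,a_r⟩ whenever g does, with d = (c a_r, c a_r) we get
-- d u d⁻¹ = (c u c⁻¹, id)σ. Iterating from u gives group elements
-- (⋯((u, id)σ, id)σ ⋯, id)σ, which agree with γ = (γ, id)σ on ever deeper levels.
module Submission where

open import Defs
open import Data.Bool using (Bool; true; false; not)
open import Data.Fin using (Fin; zero; suc; fromℕ; inject₁; toℕ)
open import Data.Fin.Properties using (toℕ-inject₁; toℕ<n)
open import Data.Fin.Relation.Unary.Top using (view; ‵fromℕ; ‵inj₁)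
open import Data.List using ([]; _∷_; _++_; [_]; concatMap; length)
open import Data.Nat using (ℕ; zero; suc; _≤_; _<_; s≤s)
open import Data.Product using (_×_; _,_)
open import Function using (id; _∘_)
open import Relation.Binary.PropositionalEquality using (_≡_; _≗_; refl; sym; trans; cong; subst; module ≡-Reasoning)

diagonal : Act → Act
diagonal f []      = []
diagonal f (x ∷ v) = x ∷ f v

⟨_,id⟩σ : Act → Act
⟨ f ,id⟩σ []          = []
⟨ f ,id⟩σ (false ∷ v) = true ∷ f v
⟨ f ,id⟩σ (true ∷ v)  = false ∷ v

_≈[_]_ : Act → ℕ → Act → Set
f ≈[ n ] g = ∀ v → length v ≤ n → f v ≡ g v

diagonal-id : diagonal id ≗ id
diagonal-id []      = refl
diagonal-id (x ∷ v) = refl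

diagonal-∘ : ∀ f g → diagonal g ∘ diagonal f ≗ diagonal (g ∘ f)
diagonal-∘ f g []      = refl
diagonal-∘ f g (x ∷ v) = refl

diagonal-inverse : ∀ {f g} → (∀ v → f (g v) ≡ v) → ∀ v → diagonal f (diagonal g v) ≡ v
diagonal-inverse fg []      = refl
diagonal-inverse fg (x ∷ v) = cong (x ∷_) (fg v)

γ-unfold : γ ≗ ⟨ γ ,id⟩σ
γ-unfold []          = refl
γ-unfold (false ∷ v) = refl
γ-unfold (true ∷ v)  = refl

⟨,id⟩σ-≈ : ∀ {n f g} → f ≈[ n ] g → ⟨ f ,id⟩σ ≈[ suc n ] ⟨ g ,id⟩σ
⟨,id⟩σ-≈ f≈g []          _       = refl
⟨,id⟩σ-≈ f≈g (false ∷ v) (s≤s p) = cong (true ∷_) (f≈g v p)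
⟨,id⟩σ-≈ f≈g (true ∷ v)  _       = refl

inv-id : inv id ≗ id
inv-id []          = refl
inv-id (false ∷ w) = cong (false ∷_) (inv-id w)
inv-id (true ∷ w)  = cong (true ∷_) (inv-id w)

module _ (k : ℕ) where

  A : Act
  A = a k (fromℕ k)

  inv-a-a : ∀ i v → inv (a k i) (a k i v) ≡ v
  inv-a-a i       []          = refl
  inv-a-a zero    (false ∷ v) = cong (false ∷_) (inv-a-a (fromℕ k) v)
  inv-a-a zero    (true ∷ v)  = cong (true ∷_) (inv-id v)
  inv-a-a (suc i) (false ∷ v) = cong (false ∷_) (inv-a-a (inject₁ i) v)
  inv-a-a (suc i) (true ∷ v)  = cong (true ∷_) (inv-id v)

  a-inv-a : ∀ i v → a k i (inv (a k i) v) ≡ v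
  a-inv-a i       []          = refl
  a-inv-a zero    (false ∷ v) = cong (false ∷_) (inv-id v)
  a-inv-a zero    (true ∷ v)  = cong (true ∷_) (a-inv-a (fromℕ k) v)
  a-inv-a (suc i) (false ∷ v) = cong (false ∷_) (a-inv-a (inject₁ i) v)
  a-inv-a (suc i) (true ∷ v)  = cong (true ∷_) (inv-id v)

  eval-root : ∀ w → eval k w [] ≡ []
  eval-root []                = refl
  eval-root ((i , false) ∷ w) = eval-root w
  eval-root ((i , true) ∷ w)  = eval-root w

  eval-++ : ∀ xs ys v → eval k (xs ++ ys) v ≡ eval k ys (eval k xs v)
  eval-++ []       ys v = refl
  eval-++ (g ∷ xs) ys v = eval-++ xs ys (gen k g v)

  flipLetter : Fin (suc k) × Bool → Fin (suc k) × Bool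
  flipLetter (i , b) = i , not b

  invert : GroupWord k → GroupWord k
  invert []       = []
  invert (g ∷ gs) = invert gs ++ [ flipLetter g ]

  invert-snoc : ∀ w g → invert (w ++ [ g ]) ≡ flipLetter g ∷ invert w
  invert-snoc []       g = refl
  invert-snoc (h ∷ w) g = cong (_++ [ flipLetter h ]) (invert-snoc w g)

  gen-flipLetter-cancelˡ : ∀ g v → gen k (flipLetter g) (gen k g v) ≡ v
  gen-flipLetter-cancelˡ (i , false) = inv-a-a i
  gen-flipLetter-cancelˡ (i , true)  = a-inv-a i

  gen-flipLetter-cancelʳ : ∀ g v → gen k g (gen k (flipLetter g) v) ≡ v
  gen-flipLetter-cancelʳ (i , false) = a-inv-a i
  gen-flipLetter-cancelʳ (i , true)  = inv-a-a i

  eval-invert-cancelˡ : ∀ w v → eval k (invert w) (eval k w v) ≡ v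
  eval-invert-cancelˡ []       v = refl
  eval-invert-cancelˡ (g ∷ gs) v = begin
    eval k (invert gs ++ [ flipLetter g ]) (eval k gs (gen k g v))
      ≡⟨ eval-++ (invert gs) _ _ ⟩
    gen k (flipLetter g) (eval k (invert gs) (eval k gs (gen k g v)))
      ≡⟨ cong (gen k (flipLetter g)) (eval-invert-cancelˡ gs (gen k g v)) ⟩
    gen k (flipLetter g) (gen k g v)
      ≡⟨ gen-flipLetter-cancelˡ g v ⟩
    v ∎
    where open ≡-Reasoning

  eval-invert-cancelʳ : ∀ w v → eval k w (eval k (invert w) v) ≡ v
  eval-invert-cancelʳ []       v = refl
  eval-invert-cancelʳ (g ∷ gs) v = begin
    eval k gs (gen k g (eval k (invert gs ++ [ flipLetter g ]) v))
      ≡⟨ cong (eval k gs ∘ gen k g) (eval-++ (invert gs) _ v) ⟩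
    eval k gs (gen k g (gen k (flipLetter g) (eval k (invert gs) v)))
      ≡⟨ cong (eval k gs) (gen-flipLetter-cancelʳ g _) ⟩
    eval k gs (eval k (invert gs) v)
      ≡⟨ eval-invert-cancelʳ gs v ⟩
    v ∎
    where open ≡-Reasoning

  eval-invert : ∀ w {f g} → eval k w ≗ f → (∀ v → f (g v) ≡ v) → eval k (invert w) ≗ g
  eval-invert w {f} {g} w≗f fg v = begin
    eval k (invert w) v                ≡⟨ cong (eval k (invert w)) (sym (fg v)) ⟩
    eval k (invert w) (f (g v))        ≡⟨ cong (eval k (invert w)) (sym (w≗f (g v))) ⟩
    eval k (invert w) (eval k w (g v)) ≡⟨ eval-invert-cancelˡ w (g v) ⟩
    g v ∎
    where open ≡-Reasoning

  -- (a_r, a_r) = a₁², and (a_{i+1}, a_{i+1}) = a_{i+2} a₁ a_{i+2} a₁⁻¹ for i < r - 1.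
  diagonalGenerator : Fin (suc k) → GroupWord k
  diagonalGenerator j with view j
  ... | ‵fromℕ           = (zero , false) ∷ (zero , false) ∷ []
  ... | ‵inj₁ {i = i} _  = (suc i , false) ∷ (zero , false) ∷ (suc i , false) ∷ (zero , true) ∷ []

  eval-diagonalGenerator : ∀ j → eval k (diagonalGenerator j) ≗ diagonal (a k j)
  eval-diagonalGenerator j []      = eval-root (diagonalGenerator j)
  eval-diagonalGenerator j (x ∷ v) with view j
  eval-diagonalGenerator _ (false ∷ v) | ‵fromℕ = refl
  eval-diagonalGenerator _ (true ∷ v)  | ‵fromℕ = refl
  eval-diagonalGenerator _ (false ∷ v) | ‵inj₁ {i = i} _ =
    cong (false ∷_) (inv-a-a (fromℕ k) (a k (inject₁ i) v))
  eval-diagonalGenerator _ (true ∷ v)  | ‵inj₁ {i = i} _ =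
    cong (true ∷_) (inv-id (a k (inject₁ i) v))

  diagonalLetter : Fin (suc k) × Bool → GroupWord k
  diagonalLetter (j , false) = diagonalGenerator j
  diagonalLetter (j , true)  = invert (diagonalGenerator j)

  eval-diagonalLetter : ∀ g → eval k (diagonalLetter g) ≗ diagonal (gen k g)
  eval-diagonalLetter (j , false) = eval-diagonalGenerator j
  eval-diagonalLetter (j , true)  =
    eval-invert (diagonalGenerator j) (eval-diagonalGenerator j) (diagonal-inverse (a-inv-a j))

  diagonalWord : GroupWord k → GroupWord k
  diagonalWord = concatMap diagonalLetter

  eval-diagonalWord : ∀ w → eval k (diagonalWord w) ≗ diagonal (eval k w)
  eval-diagonalWord []       v = sym (diagonal-id v)
  eval-diagonalWord (g ∷ gs) v = begin
    eval k (diagonalLetter g ++ diagonalWord gs) v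
      ≡⟨ eval-++ (diagonalLetter g) _ v ⟩
    eval k (diagonalWord gs) (eval k (diagonalLetter g) v)
      ≡⟨ cong (eval k (diagonalWord gs)) (eval-diagonalLetter g v) ⟩
    eval k (diagonalWord gs) (diagonal (gen k g) v)
      ≡⟨ eval-diagonalWord gs _ ⟩
    diagonal (eval k gs) (diagonal (gen k g) v)
      ≡⟨ diagonal-∘ (gen k g) (eval k gs) v ⟩
    diagonal (eval k (g ∷ gs)) v ∎
    where open ≡-Reasoning

  eval-invert-diagonalWord : ∀ w → eval k (invert (diagonalWord w)) ≗ diagonal (eval k (invert w))
  eval-invert-diagonalWord w =
    eval-invert (diagonalWord w) (eval-diagonalWord w) (diagonal-inverse (eval-invert-cancelʳ w))

  -- descending m j is a_{j+1} a_j ⋯ a₁ as long as the fuel m exceeds toℕ j.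
  descending : ℕ → Fin (suc k) → GroupWord k
  descending zero    j       = []
  descending (suc m) zero    = [ zero , false ]
  descending (suc m) (suc i) = (suc i , false) ∷ descending m (inject₁ i)

  inject₁-< : ∀ {m} (i : Fin k) → toℕ i < m → toℕ (inject₁ i) < m
  inject₁-< {m} i = subst (_< m) (sym (toℕ-inject₁ i))

  eval-descending-true : ∀ m j → toℕ j < m → ∀ v → eval k (descending m j) (true ∷ v) ≡ false ∷ v
  eval-descending-true (suc m) zero    _       v = refl
  eval-descending-true (suc m) (suc i) (s≤s p) v = eval-descending-true m (inject₁ i) (inject₁-< i p) v

  eval-descending-false : ∀ m j → toℕ j < m → ∀ v →
    eval k (descending m j) (false ∷ a k j v) ≡ true ∷ A (eval k (descending m j) v)
  eval-descending-false (suc m) zero    _       v = refl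
  eval-descending-false (suc m) (suc i) (s≤s p) v =
    eval-descending-false m (inject₁ i) (inject₁-< i p) (a k (suc i) v)

  seed : GroupWord k
  seed = descending (suc k) (fromℕ k)

  eval-seed-true : ∀ v → eval k seed (true ∷ v) ≡ false ∷ v
  eval-seed-true = eval-descending-true (suc k) (fromℕ k) (toℕ<n (fromℕ k))

  eval-seed-false : ∀ v → eval k seed (false ∷ A v) ≡ true ∷ A (eval k seed v)
  eval-seed-false = eval-descending-false (suc k) (fromℕ k) (toℕ<n (fromℕ k))

  conjugate : GroupWord k → GroupWord k → GroupWord k
  conjugate c u = c ++ u ++ invert c

  eval-conjugate : ∀ c u v → eval k (conjugate c u) v ≡ eval k (invert c) (eval k u (eval k c v))
  eval-conjugate c u v = trans (eval-++ c _ v) (eval-++ u (invert c) _)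

  conjugate-lift : ∀ c → let d = c ++ [ fromℕ k , false ] in
    eval k (conjugate (diagonalWord d) seed) ≗ ⟨ eval k (conjugate c seed) ,id⟩σ
  conjugate-lift c []          = eval-root (conjugate (diagonalWord (c ++ _)) seed)
  conjugate-lift c (false ∷ v) = begin
    eval k (conjugate (diagonalWord d) seed) (false ∷ v)
      ≡⟨ eval-conjugate (diagonalWord d) seed _ ⟩
    eval k (invert (diagonalWord d)) (eval k seed (eval k (diagonalWord d) (false ∷ v)))
      ≡⟨ cong (eval k (invert (diagonalWord d)) ∘ eval k seed)
              (trans (eval-diagonalWord d _) (cong (false ∷_) (eval-++ c _ v))) ⟩
    eval k (invert (diagonalWord d)) (eval k seed (false ∷ A cv))
      ≡⟨ cong (eval k (invert (diagonalWord d))) (eval-seed-false cv) ⟩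
    eval k (invert (diagonalWord d)) (true ∷ A (eval k seed cv))
      ≡⟨ eval-invert-diagonalWord d _ ⟩
    true ∷ eval k (invert d) (A (eval k seed cv))
      ≡⟨ cong (λ w → true ∷ eval k w (A (eval k seed cv))) (invert-snoc c _) ⟩
    true ∷ eval k (invert c) (inv A (A (eval k seed cv)))
      ≡⟨ cong (λ x → true ∷ eval k (invert c) x) (inv-a-a (fromℕ k) _) ⟩
    true ∷ eval k (invert c) (eval k seed cv)
      ≡⟨ cong (true ∷_) (eval-conjugate c seed v) ⟨
    true ∷ eval k (conjugate c seed) v ∎
    where
    open ≡-Reasoning
    d  = c ++ [ fromℕ k , false ]
    cv = eval k c v
  conjugate-lift c (true ∷ v) = begin
    eval k (conjugate (diagonalWord d) seed) (true ∷ v)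
      ≡⟨ eval-conjugate (diagonalWord d) seed _ ⟩
    eval k (invert (diagonalWord d)) (eval k seed (eval k (diagonalWord d) (true ∷ v)))
      ≡⟨ cong (eval k (invert (diagonalWord d)) ∘ eval k seed) (eval-diagonalWord d _) ⟩
    eval k (invert (diagonalWord d)) (eval k seed (true ∷ eval k d v))
      ≡⟨ cong (eval k (invert (diagonalWord d))) (eval-seed-true _) ⟩
    eval k (invert (diagonalWord d)) (false ∷ eval k d v)
      ≡⟨ eval-invert-diagonalWord d _ ⟩
    false ∷ eval k (invert d) (eval k d v)
      ≡⟨ cong (false ∷_) (eval-invert-cancelˡ d v) ⟩
    false ∷ v ∎
    where
    open ≡-Reasoning
    d = c ++ [ fromℕ k , false ]

  conjugator : ℕ → GroupWord k
  conjugator zero    = []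
  conjugator (suc n) = diagonalWord (conjugator n ++ [ fromℕ k , false ])

  approximant : ℕ → GroupWord k
  approximant n = conjugate (conjugator n) seed

  approximant-≈-γ : ∀ n → eval k (approximant n) ≈[ n ] γ
  approximant-≈-γ zero    []      _ = eval-root (approximant zero)
  approximant-≈-γ (suc n) v       p = begin
    eval k (approximant (suc n)) v              ≡⟨ conjugate-lift (conjugator n) v ⟩
    ⟨ eval k (approximant n) ,id⟩σ v            ≡⟨ ⟨,id⟩σ-≈ (approximant-≈-γ n) v p ⟩
    ⟨ γ ,id⟩σ v                                ≡⟨ γ-unfold v ⟨
    γ v ∎
    where open ≡-Reasoning

proposition5p1 : (k : ℕ) → 2 ≤ suc k → InClosure k γ
proposition5p1 k _ n = approximant k n , approximant-≈-γ k n
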